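{- Let $\mathcal{A}$ be a reflexive graph and let $(U,E)$ be a univalent universe. Assume function extensionality. Then the type of oplax covariant lenses of $U$-small path objects over $\mathcal{A}$ is equivalent to the type of covariant fibrations of $U$-small reflexive graphs over $\mathcal{A}$. Likewise, the type of lax contravariant lenses of $U$-small path objects over $\mathcal{A}$ is equivalent to the type of contravariant fibrations of $U$-small reflexive graphs over $\mathcal{A}$.
   Context: Work in intensional Martin-Löf type theory with $\Pi$, $\Sigma$ (with definitional $\eta$), identity types $x =_A y$ and a unit type. A type is a proposition if any two of its elements are identified. A universe $(U,E)$ is a type $U$ with a family of types $E(A)$ for $A:U$ (one writes $A$ for $E(A)$); it is univalent if for all $A,B:U$ the canonical map $(A=_U B)\to\mathsf{Equiv}(E(A),E(B))$ (sending $\mathsf{refl}$ to the identity) is an equivalence. A reflexive graph $\mathcal{G}$ consists of a type $|\mathcal{G}|$ of vertices, a type $x\approx_{\mathcal{G}}y$ of edges for $x,y:|\mathcal{G}|$, and $\mathsf{rx}_{\mathcal{G}}(x):x\approx_{\mathcal{G}}x$; it is $U$-small if its vertex and edge types are (decodings of) elements of $U$. The fan of $x$ is $\sum_{y:|\mathcal{G}|}x\approx_{\mathcal{G}}y$; $\mathcal{G}$ is univalent (a path object) if every fan is a proposition. A displayed reflexive graph $\mathcal{B}$ over $\mathcal{A}$ consists of types $|\mathcal{B}|(x)$ for $x:|\mathcal{A}|$, types $u\approx^{\mathcal{B}}_p v$ for $p:x\approx_{\mathcal{A}}y$, $u:|\mathcal{B}|(x)$, $v:|\mathcal{B}|(y)$,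 and $\mathsf{rx}^{\mathcal{B}}_x(u):u\approx^{\mathcal{B}}_{\mathsf{rx}_{\mathcal{A}}(x)}u$. It is a covariant fibration if for all $p:x\approx_{\mathcal{A}}y$ and $u:|\mathcal{B}|(x)$ the type $\sum_{v:|\mathcal{B}|(y)}u\approx^{\mathcal{B}}_p v$ is contractible, and a contravariant fibration if for all $p:x\approx_{\mathcal{A}}y$ and $v:|\mathcal{B}|(y)$ the type $\sum_{v':|\mathcal{B}|(x)}v'\approx^{\mathcal{B}}_p v$ is contractible. An oplax covariant lens over $\mathcal{A}$ is a family of reflexive graphs $\mathcal{B}(x)$ ($x:|\mathcal{A}|$) with $\mathsf{push}_p:|\mathcal{B}(x)|\to|\mathcal{B}(y)|$ for each $p:x\approx_{\mathcal{A}}y$ and $\mathsf{pushRx}_x(u):\mathsf{push}_{\mathsf{rx}_{\mathcal{A}}(x)}u\approx_{\mathcal{B}(x)}u$. A lax contravariant lens over $\mathcal{A}$ is a family of reflexive graphs $\mathcal{B}(x)$ with $\mathsf{pull}_p:|\mathcal{B}(y)|\to|\mathcal{B}(x)|$ for $p:x\approx_{\mathcal{A}}y$ and $\mathsf{pullRx}_x(u):u\approx_{\mathcal{B}(x)}\mathsf{pull}_{\mathsf{rx}_{\mathcal{A}}(x)}u$. A lens of ($U$-small) path objects is one whose components $\mathcal{B}(x)$ are ($U$-small) path objects. A fibration of $U$-small reflexive graphs is one whose displayed vertex and edge types are $U$-small. -}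

{-# OPTIONS --without-K #-}
module Defs where

open import Level using (Level; _⊔_; suc; Setω)
open import Relation.Binary.PropositionalEquality using (_≡_; refl)
open import Data.Product using (Σ; Σ-syntax; _,_; proj₁; proj₂)
open import Axiom.Extensionality.Propositional using (Extensionality)

private variable ℓ ℓ' : Level

isContr : Set ℓ → Set ℓ
isContr A = Σ[ c ∈ A ] ((a : A) → c ≡ a)

isProp : Set ℓ → Set ℓ
isProp A = (a b : A) → a ≡ b

fiber : {A : Set ℓ} {B : Set ℓ'} → (A → B) → B → Set (ℓ ⊔ ℓ')
fiber {A = A} f b = Σ[ a ∈ A ] (f a ≡ b)

isEquiv : {A : Set ℓ} {B : Set ℓ'} → (A → B) → Set (ℓ ⊔ ℓ')
isEquiv {B = B} f = (b : B) → isContr (fiber f b)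

Equiv : Set ℓ → Set ℓ' → Set (ℓ ⊔ ℓ')
Equiv A B = Σ[ f ∈ (A → B) ] isEquiv f

idIsEquiv : (A : Set ℓ) → isEquiv (λ (a : A) → a)
idIsEquiv A b = (b , refl) , λ { (a , refl) → refl }

idEquiv : (A : Set ℓ) → Equiv A A
idEquiv A = (λ a → a) , idIsEquiv A

FunExt : Setω
FunExt = ∀ {a b} → Extensionality a b

record Universe (u e : Level) : Set (suc (u ⊔ e)) where
  field
    U : Set u
    E : U → Set e

module _ {u e} (𝒰 : Universe u e) where
  open Universe 𝒰

  idToEquiv : {A B : U} → A ≡ B → Equiv (E A) (E B)
  idToEquiv {A} refl = idEquiv (E A)

  isUnivalent : Set (u ⊔ e)
  isUnivalent = (A B : U) → isEquiv (idToEquiv {A} {B})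

record ReflGraph (a b : Level) : Set (suc (a ⊔ b)) where
  field
    Vert : Set a
    Edge : Vert → Vert → Set b
    rx   : (x : Vert) → Edge x x
open ReflGraph public

isPathObject : ∀ {a b} → ReflGraph a b → Set (a ⊔ b)
isPathObject 𝒢 = (x : Vert 𝒢) → isProp (Σ[ y ∈ Vert 𝒢 ] Edge 𝒢 x y)

module _ {u e} (𝒰 : Universe u e) where
  open Universe 𝒰

  record SmallReflGraph : Set (u ⊔ e) where
    field
      sVert : U
      sEdge : E sVert → E sVert → U
      sRx   : (x : E sVert) → E (sEdge x x)

  toReflGraph : SmallReflGraph → ReflGraph e e
  toReflGraph G = record
    { Vert = E (SmallReflGraph.sVert G)
    ; Edge = λ x y → E (SmallReflGraph.sEdge G x y)
    ; rx   = SmallReflGraph.sRx G }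

  module _ {a b} (𝒜 : ReflGraph a b) where

    record OplaxCovLens : Set (a ⊔ b ⊔ u ⊔ e) where
      field
        fam     : Vert 𝒜 → SmallReflGraph
        pathObj : (x : Vert 𝒜) → isPathObject (toReflGraph (fam x))
        push    : {x y : Vert 𝒜} → Edge 𝒜 x y
                → Vert (toReflGraph (fam x)) → Vert (toReflGraph (fam y))
        pushRx  : (x : Vert 𝒜) (v : Vert (toReflGraph (fam x)))
                → Edge (toReflGraph (fam x)) (push (rx 𝒜 x) v) v

    record LaxContraLens : Set (a ⊔ b ⊔ u ⊔ e) where
      field
        fam     : Vert 𝒜 → SmallReflGraph
        pathObj : (x : Vert 𝒜) → isPathObject (toReflGraph (fam x))
        pull    : {x y : Vert 𝒜} → Edge 𝒜 x y
                → Vert (toReflGraph (fam y)) → Vert (toReflGraph (fam x))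
        pullRx  : (x : Vert 𝒜) (v : Vert (toReflGraph (fam x)))
                → Edge (toReflGraph (fam x)) v (pull (rx 𝒜 x) v)

    record SmallDispReflGraph : Set (a ⊔ b ⊔ u ⊔ e) where
      field
        dVert : Vert 𝒜 → U
        dEdge : {x y : Vert 𝒜} → Edge 𝒜 x y → E (dVert x) → E (dVert y) → U
        dRx   : (x : Vert 𝒜) (v : E (dVert x)) → E (dEdge (rx 𝒜 x) v v)

    isCovFibration : SmallDispReflGraph → Set (a ⊔ b ⊔ e)
    isCovFibration ℬ = {x y : Vert 𝒜} (p : Edge 𝒜 x y) (v : E (dVert x))
                     → isContr (Σ[ w ∈ E (dVert y) ] E (dEdge p v w))
      where open SmallDispReflGraph ℬ

    isContraFibration : SmallDispReflGraph → Set (a ⊔ b ⊔ e)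
    isContraFibration ℬ = {x y : Vert 𝒜} (p : Edge 𝒜 x y) (w : E (dVert y))
                        → isContr (Σ[ v ∈ E (dVert x) ] E (dEdge p v w))
      where open SmallDispReflGraph ℬ

    CovFibration : Set (a ⊔ b ⊔ u ⊔ e)
    CovFibration = Σ SmallDispReflGraph isCovFibration

    ContraFibration : Set (a ⊔ b ⊔ u ⊔ e)
    ContraFibration = Σ SmallDispReflGraph isContraFibration

{-# OPTIONS --without-K #-}
-- A lens determines a displayed graph with edges u ≈ₚ w := push p u ≈ w; it is a
-- covariant fibration because fans in a path object are contractible.  Conversely a
-- covariant fibration gives the lens whose fibres are the graphs over reflexive
-- edges, with push p u the centre of the fan of u over p.  Lens → fibration → lens
-- is the identity because the pairs (push rx, pushRx) form a contractible type, so we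
-- may assume push rx = id.  Fibration → lens → fibration is the identity by
-- univalence: u ≈ₚ w and push p u ≈ w are two families over w with contractible
-- total spaces sharing a point, hence fibrewise equivalent.  The contravariant
-- case is the covariant one over the opposite graph.
module Submission where

open import Level using (Level; _⊔_)
open import Data.Product using (_×_; Σ; Σ-syntax; _,_; proj₁; proj₂)
open import Relation.Binary.PropositionalEquality using (_≡_; refl; sym; trans; cong; cong₂; subst)
open import Relation.Binary.PropositionalEquality.Properties using (trans-symˡ)
open import Axiom.Extensionality.Propositional using (implicit-extensionality)
open import Function.Bundles using (_↔_; mk↔ₛ′)
open import Function.Properties.Inverse using (↔-trans)
open import Function.Properties.Inverse.HalfAdjointEquivalence using (_≃_; ↔⇒≃)
open import Defs

private variable ℓ ℓ' ℓ'' : Level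

isContr→isProp : {A : Set ℓ} → isContr A → isProp A
isContr→isProp (c , h) x y = trans (sym (h x)) (h y)

isContr→isProp-refl : {A : Set ℓ} (C : isContr A) (x : A) → isContr→isProp C x x ≡ refl
isContr→isProp-refl (_ , h) x = trans-symˡ (h x)

isProp→isSet : {A : Set ℓ} → isProp A → (x y : A) (p q : x ≡ y) → p ≡ q
isProp→isSet P x y p q = trans (canonical p) (sym (canonical q))
  where
  canonical : ∀ {z} (p : x ≡ z) → p ≡ trans (sym (P x x)) (P x z)
  canonical refl = sym (trans-symˡ (P x x))

isContr-retract : {A : Set ℓ} {B : Set ℓ'} (r : A → B) (s : B → A)
  → (∀ b → r (s b) ≡ b) → isContr A → isContr B
isContr-retract r s rs (c , h) = r c , λ b → trans (cong r (h (s b))) (rs b)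

singleton-isContr : {A : Set ℓ} (a : A) → isContr (Σ A λ b → a ≡ b)
singleton-isContr a = (a , refl) , λ { (b , refl) → refl }

singleton′-isContr : {A : Set ℓ} (a : A) → isContr (Σ A λ b → b ≡ a)
singleton′-isContr a = (a , refl) , λ { (b , refl) → refl }

Σ-≡-prop : {A : Set ℓ} {B : A → Set ℓ'} → (∀ a → isProp (B a))
  → {a a' : A} {b : B a} {b' : B a'} → a ≡ a' → _≡_ {A = Σ A B} (a , b) (a' , b')
Σ-≡-prop B-isProp {b = b} {b'} refl = cong (_ ,_) (B-isProp _ b b')

-- A family with contractible total space is inductively generated by any one of
-- its points, just as the based path family is by refl.
module _ {A : Set ℓ} {B : A → Set ℓ'} (C : isContr (Σ A B)) (a₀ : A) (b₀ : B a₀) where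

  Σ-contr-elim : (P : (a : A) → B a → Set ℓ'') → P a₀ b₀ → (a : A) (b : B a) → P a b
  Σ-contr-elim P p a b = subst (λ z → P (proj₁ z) (proj₂ z)) (isContr→isProp C (a₀ , b₀) (a , b)) p

  Σ-contr-elim-β : (P : (a : A) → B a → Set ℓ'') (p : P a₀ b₀) → Σ-contr-elim P p a₀ b₀ ≡ p
  Σ-contr-elim-β P p rewrite isContr→isProp-refl C (a₀ , b₀) = refl

↔⇒Equiv : {A : Set ℓ} {B : Set ℓ'} → A ↔ B → Equiv A B
↔⇒Equiv A↔B = to , fibres-isContr
  where
  open _≃_ (↔⇒≃ A↔B)
  fibre-path : ∀ {a x} (p : x ≡ a) → _≡_ {A = fiber to (to a)} (x , cong to p) (a , refl)
  fibre-path refl = refl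
  fibres-isContr : isEquiv to
  fibres-isContr b = (from b , right-inverse-of b) , λ { (a , refl) →
    trans (cong (λ q → (from (to a) , q)) (sym (left-right a))) (fibre-path (left-inverse-of a)) }

fibrewise-↔-of-isContr-total : {X : Set ℓ} (P : X → Set ℓ') (Q : X → Set ℓ'')
  → isContr (Σ X P) → isContr (Σ X Q)
  → (a : X) → P a → Q a → ∀ w → P w ↔ Q w
fibrewise-↔-of-isContr-total P Q CP CQ a p₀ q₀ w = mk↔ₛ′ (to w) (from w) (to-from w) (from-to w)
  where
  to : ∀ w → P w → Q w
  to = Σ-contr-elim CP a p₀ (λ w _ → Q w) q₀
  from : ∀ w → Q w → P w
  from = Σ-contr-elim CQ a q₀ (λ w _ → P w) p₀
  from-to : ∀ w k → from w (to w k) ≡ k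
  from-to = Σ-contr-elim CP a p₀ (λ w k → from w (to w k) ≡ k)
    (trans (cong (from a) (Σ-contr-elim-β CP a p₀ _ q₀)) (Σ-contr-elim-β CQ a q₀ _ p₀))
  to-from : ∀ w k → to w (from w k) ≡ k
  to-from = Σ-contr-elim CQ a q₀ (λ w k → to w (from w k) ≡ k)
    (trans (cong (to a) (Σ-contr-elim-β CQ a q₀ _ p₀)) (Σ-contr-elim-β CP a p₀ _ q₀))

module _ (fe : FunExt) where

  Π-isContr : {A : Set ℓ} {B : A → Set ℓ'} → (∀ x → isContr (B x)) → isContr ((x : A) → B x)
  Π-isContr C = (λ x → proj₁ (C x)) , λ f → fe λ x → proj₂ (C x) (f x)

  isProp-isContr : {A : Set ℓ} → isProp (isContr A)
  isProp-isContr (c , h) (c' , h') = Σ-≡-prop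
    (λ _ k k' → fe λ x → isProp→isSet (isContr→isProp (c , h)) _ _ (k x) (k' x)) (h c')

  isProp-isProp : {A : Set ℓ} → isProp (isProp A)
  isProp-isProp P Q = fe λ x → fe λ y → isProp→isSet P x y (P x y) (Q x y)

  isPathObject-isProp : ∀ {a b} (𝒢 : ReflGraph a b) → isProp (isPathObject 𝒢)
  isPathObject-isProp 𝒢 P Q = fe λ x → isProp-isProp (P x) (Q x)

module _ {X : Set ℓ} (R : X → X → Set ℓ') (r : ∀ x → R x x)
         (fan-isContr : ∀ x → isContr (Σ X (R x))) where

  fan-reverse : ∀ v w → R v w → R w v
  fan-reverse v = Σ-contr-elim (fan-isContr v) v (r v) (λ w _ → R w v) (r v)

  fan-reverse-β : ∀ v → fan-reverse v v (r v) ≡ r v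
  fan-reverse-β v = Σ-contr-elim-β (fan-isContr v) v (r v) (λ w _ → R w v) (r v)

  fan-transport-rx≡fan-reverse : ∀ v c (k : R v c)
    → Σ-contr-elim (fan-isContr v) c k (λ w _ → R c w) (r c) v (r v) ≡ fan-reverse v c k
  fan-transport-rx≡fan-reverse v = Σ-contr-elim (fan-isContr v) v (r v)
    (λ c k → Σ-contr-elim (fan-isContr v) c k (λ w _ → R c w) (r c) v (r v) ≡ fan-reverse v c k)
    (trans (Σ-contr-elim-β (fan-isContr v) v (r v) (λ w _ → R v w) (r v)) (sym (fan-reverse-β v)))

isPathObject→fan-isContr : ∀ {a b} (𝒢 : ReflGraph a b) → isPathObject 𝒢
  → (x : Vert 𝒢) → isContr (Σ (Vert 𝒢) (Edge 𝒢 x))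
isPathObject→fan-isContr 𝒢 po x = (x , rx 𝒢 x) , po x (x , rx 𝒢 x)

-- A path object is an identity system: its edges are the paths.
module _ {a b} (𝒢 : ReflGraph a b) (po : isPathObject 𝒢) where
  private
    fan-isContr : (x : Vert 𝒢) → isContr (Σ (Vert 𝒢) (Edge 𝒢 x))
    fan-isContr = isPathObject→fan-isContr 𝒢 po

  edge→≡ : ∀ {x y} → Edge 𝒢 x y → x ≡ y
  edge→≡ {x} k = cong proj₁ (isContr→isProp (fan-isContr x) (x , rx 𝒢 x) (_ , k))

  ≡→edge : ∀ {x y} → x ≡ y → Edge 𝒢 x y
  ≡→edge {x} refl = rx 𝒢 x

  ≡→edge-edge→≡ : ∀ {x y} (k : Edge 𝒢 x y) → ≡→edge (edge→≡ k) ≡ k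
  ≡→edge-edge→≡ {x} {y} k = Σ-contr-elim (fan-isContr x) x (rx 𝒢 x)
    (λ y k → ≡→edge (edge→≡ k) ≡ k)
    (cong (λ q → ≡→edge (cong proj₁ q)) (isContr→isProp-refl (fan-isContr x) (x , rx 𝒢 x))) y k

  cofan-isContr : ∀ y → isContr (Σ (Vert 𝒢) λ x → Edge 𝒢 x y)
  cofan-isContr y = isContr-retract (λ { (x , p) → x , ≡→edge p }) (λ { (x , k) → x , edge→≡ k })
    (λ { (x , k) → cong (x ,_) (≡→edge-edge→≡ k) }) (singleton′-isContr y)

  endo-with-edges-to-id-isContr : FunExt
    → isContr (Σ (Vert 𝒢 → Vert 𝒢) λ f → ∀ v → Edge 𝒢 (f v) v)
  endo-with-edges-to-id-isContr fe =
    isContr-retract (λ φ → (λ v → proj₁ (φ v)) , λ v → proj₂ (φ v))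
      (λ { (f , h) v → f v , h v }) (λ _ → refl) (Π-isContr fe cofan-isContr)

opReflGraph : ∀ {a b} → ReflGraph a b → ReflGraph a b
opReflGraph 𝒢 = record { Vert = Vert 𝒢 ; Edge = λ x y → Edge 𝒢 y x ; rx = rx 𝒢 }

opReflGraph-isPathObject : ∀ {a b} (𝒢 : ReflGraph a b)
  → isPathObject 𝒢 → isPathObject (opReflGraph 𝒢)
opReflGraph-isPathObject 𝒢 po y = isContr→isProp (cofan-isContr 𝒢 po y)

module _ {u e} (𝒰 : Universe u e) (fe : FunExt) where
  open Universe 𝒰

  codedGraph : (X : Set e) (Ed : X → X → U) → (∀ x → E (Ed x x)) → ReflGraph e e
  codedGraph X Ed r = record { Vert = X ; Edge = λ x y → E (Ed x y) ; rx = r }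

  -- The data of an oplax lens over a single vertex x, for f = push (rx x).
  PathObjectWithCounit : (X : Set e) → (X → X) → Set (u ⊔ e)
  PathObjectWithCounit X f = Σ[ Ed ∈ (X → X → U) ] Σ[ r ∈ (∀ x → E (Ed x x)) ]
    isPathObject (codedGraph X Ed r) × (∀ v → E (Ed (f v) v))

  precomposeEdges : {X : Set e} (f : X → X) → PathObjectWithCounit X f → PathObjectWithCounit X f
  precomposeEdges {X} f (Ed , r , po , h) =
    (λ u w → Ed (f u) w) , h , (λ x → isContr→isProp (fan-isContr x)) ,
    λ v → fan-reverse (λ u w → E (Ed (f u) w)) h fan-isContr v (f v) (r (f v))
    where
    fan-isContr : ∀ x → isContr (Σ X λ w → E (Ed (f x) w))
    fan-isContr x = isPathObject→fan-isContr (codedGraph X Ed r) po (f x)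

  precomposeEdges≡id : {X : Set e} (f : X → X) (s : PathObjectWithCounit X f)
    → precomposeEdges f s ≡ s
  precomposeEdges≡id {X} f (Ed , r , po , h) =
    Σ-contr-elim (endo-with-edges-to-id-isContr 𝒢 po fe) (λ x → x) r
      (λ f h → precomposeEdges f (Ed , r , po , h) ≡ (Ed , r , po , h)) at-id f h
    where
    𝒢 : ReflGraph e e
    𝒢 = codedGraph X Ed r
    at-id : precomposeEdges (λ x → x) (Ed , r , po , r) ≡ (Ed , r , po , r)
    at-id = cong (λ q → Ed , r , q) (cong₂ _,_ (isPathObject-isProp fe 𝒢 _ po)
      (fe λ v → fan-reverse-β (Edge 𝒢) r (isPathObject→fan-isContr 𝒢 po) v))

module _ {u e} (𝒰 : Universe u e) (univ : isUnivalent 𝒰) (fe : FunExt) where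
  open Universe 𝒰

  equiv-fan-isContr : (A : U) → isContr (Σ U λ B → Equiv (E A) (E B))
  equiv-fan-isContr A = isContr-retract (λ { (B , p) → B , idToEquiv 𝒰 p })
    (λ { (B , eq) → B , proj₁ (proj₁ (univ A B eq)) })
    (λ { (B , eq) → cong (B ,_) (proj₂ (proj₁ (univ A B eq))) })
    (singleton-isContr A)

  family-equiv-fan-isContr : {I : Set ℓ} (D : I → U)
    → isContr (Σ (I → U) λ D' → ∀ i → Equiv (E (D i)) (E (D' i)))
  family-equiv-fan-isContr D = isContr-retract (λ φ → (λ i → proj₁ (φ i)) , λ i → proj₂ (φ i))
    (λ { (D' , eq) i → D' i , eq i }) (λ _ → refl) (Π-isContr fe λ i → equiv-fan-isContr (D i))

  -- Structure identity principle for U-valued families carrying a section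
  -- over the image of ι.
  family-with-points-≡ : {I : Set ℓ} {J : Set ℓ'} (ι : J → I)
    (D D' : I → U) (ρ : ∀ j → E (D (ι j))) (ρ' : ∀ j → E (D' (ι j)))
    (eq : ∀ i → Equiv (E (D i)) (E (D' i))) → (∀ j → proj₁ (eq (ι j)) (ρ j) ≡ ρ' j)
    → _≡_ {A = Σ (I → U) λ D → ∀ j → E (D (ι j))} (D , ρ) (D' , ρ')
  family-with-points-≡ ι D D' ρ ρ' eq =
    Σ-contr-elim (family-equiv-fan-isContr D) D (λ i → idEquiv (E (D i)))
      (λ D' eq → (ρ' : ∀ j → E (D' (ι j))) → (∀ j → proj₁ (eq (ι j)) (ρ j) ≡ ρ' j)
               → (D , ρ) ≡ (D' , ρ'))
      (λ ρ' ρ≡ρ' → cong (D ,_) (fe ρ≡ρ')) D' eq ρ'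

  module Covariant {a b} (𝒜 : ReflGraph a b) where

    lens→fibration : OplaxCovLens 𝒰 𝒜 → CovFibration 𝒰 𝒜
    lens→fibration L =
      record { dVert = λ x → sVert (fam x)
             ; dEdge = λ {x} {y} p u w → sEdge (fam y) (push p u) w
             ; dRx   = pushRx }
      , λ {x} {y} p v → isPathObject→fan-isContr (toReflGraph 𝒰 (fam y)) (pathObj y) (push p v)
      where open OplaxCovLens L
            open SmallReflGraph

    module CovFibrationOps (ℱ : CovFibration 𝒰 𝒜) where
      open SmallDispReflGraph (proj₁ ℱ) public

      fibreEdge : ∀ x → E (dVert x) → E (dVert x) → Set e
      fibreEdge x u w = E (dEdge (rx 𝒜 x) u w)

      push : ∀ {x y} → Edge 𝒜 x y → E (dVert x) → E (dVert y)
      push p u = proj₁ (proj₁ (proj₂ ℱ p u))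

      pushEdge : ∀ {x y} (p : Edge 𝒜 x y) (u : E (dVert x)) → E (dEdge p u (push p u))
      pushEdge p u = proj₂ (proj₁ (proj₂ ℱ p u))

    fibration→lens : CovFibration 𝒰 𝒜 → OplaxCovLens 𝒰 𝒜
    fibration→lens ℱ = record
      { fam     = λ x → record { sVert = dVert x ; sEdge = dEdge (rx 𝒜 x) ; sRx = dRx x }
      ; pathObj = λ x u → isContr→isProp (proj₂ ℱ (rx 𝒜 x) u)
      ; push    = push
      ; pushRx  = λ x v → fan-reverse (fibreEdge x) (dRx x) (proj₂ ℱ (rx 𝒜 x)) v
                            (push (rx 𝒜 x) v) (pushEdge (rx 𝒜 x) v) }
      where open CovFibrationOps ℱ

    lens→fibration→lens : ∀ L → fibration→lens (lens→fibration L) ≡ L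
    lens→fibration→lens L = cong lensFromComponents (fe λ x →
      precomposeEdges≡id 𝒰 fe (push (rx 𝒜 x)) (sEdge (fam x) , sRx (fam x) , pathObj x , pushRx x))
      where
      open OplaxCovLens L
      open SmallReflGraph
      lensFromComponents : (∀ x → PathObjectWithCounit 𝒰 fe (E (sVert (fam x))) (push (rx 𝒜 x)))
        → OplaxCovLens 𝒰 𝒜
      lensFromComponents S = record
        { fam     = λ x → record { sVert = sVert (fam x)
                                 ; sEdge = proj₁ (S x)
                                 ; sRx   = proj₁ (proj₂ (S x)) }
        ; pathObj = λ x → proj₁ (proj₂ (proj₂ (S x)))
        ; push    = push
        ; pushRx  = λ x → proj₂ (proj₂ (proj₂ (S x))) }

    EdgeIndex : (Vert 𝒜 → U) → Set (a ⊔ b ⊔ e)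
    EdgeIndex V = Σ[ x ∈ Vert 𝒜 ] Σ[ y ∈ Vert 𝒜 ] Edge 𝒜 x y × E (V x) × E (V y)

    rxIndex : (V : Vert 𝒜 → U) → Σ (Vert 𝒜) (λ x → E (V x)) → EdgeIndex V
    rxIndex V (x , v) = x , x , rx 𝒜 x , v , v

    dispGraphFromFamily : (V : Vert 𝒜 → U)
      → Σ (EdgeIndex V → U) (λ D → ∀ j → E (D (rxIndex V j))) → SmallDispReflGraph 𝒰 𝒜
    dispGraphFromFamily V (D , ρ) = record
      { dVert = V ; dEdge = λ p u w → D (_ , _ , p , u , w) ; dRx = λ x v → ρ (x , v) }

    isCovFibration-isProp : (F : SmallDispReflGraph 𝒰 𝒜) → isProp (isCovFibration 𝒰 𝒜 F)
    isCovFibration-isProp F _ _ = implicit-extensionality fe (implicit-extensionality fe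
      (fe λ p → fe λ v → isProp-isContr fe _ _))

    fibration→lens→fibration : ∀ F → lens→fibration (fibration→lens F) ≡ F
    fibration→lens→fibration ℱ = Σ-≡-prop isCovFibration-isProp
      (cong (dispGraphFromFamily dVert)
        (sym (family-with-points-≡ (rxIndex dVert) D D′ ρ ρ′ D≃D′ ρ↦ρ′)))
      where
      open CovFibrationOps ℱ
      cov : isCovFibration 𝒰 𝒜 (proj₁ ℱ)
      cov = proj₂ ℱ
      D D′ : EdgeIndex dVert → U
      D  (x , y , p , u , w) = dEdge p u w
      D′ (x , y , p , u , w) = dEdge (rx 𝒜 y) (push p u) w
      ρ : ∀ j → E (D (rxIndex dVert j))
      ρ (x , v) = dRx x v
      ρ′ : ∀ j → E (D′ (rxIndex dVert j))
      ρ′ (x , v) =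
        fan-reverse (fibreEdge x) (dRx x) (cov (rx 𝒜 x)) v (push (rx 𝒜 x) v) (pushEdge (rx 𝒜 x) v)
      D≃D′ : ∀ i → Equiv (E (D i)) (E (D′ i))
      D≃D′ (x , y , p , u , w) = ↔⇒Equiv
        (fibrewise-↔-of-isContr-total (λ w → E (dEdge p u w)) (fibreEdge y (push p u))
          (cov p u) (cov (rx 𝒜 y) (push p u)) (push p u) (pushEdge p u) (dRx y (push p u)) w)
      ρ↦ρ′ : ∀ j → proj₁ (D≃D′ (rxIndex dVert j)) (ρ j) ≡ ρ′ j
      ρ↦ρ′ (x , v) = fan-transport-rx≡fan-reverse (fibreEdge x) (dRx x) (cov (rx 𝒜 x)) v
        (push (rx 𝒜 x) v) (pushEdge (rx 𝒜 x) v)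

    lens↔fibration : OplaxCovLens 𝒰 𝒜 ↔ CovFibration 𝒰 𝒜
    lens↔fibration =
      mk↔ₛ′ lens→fibration fibration→lens fibration→lens→fibration lens→fibration→lens

  opSmallReflGraph : SmallReflGraph 𝒰 → SmallReflGraph 𝒰
  opSmallReflGraph G = record { sVert = sVert ; sEdge = λ x y → sEdge y x ; sRx = sRx }
    where open SmallReflGraph G

  opSmallDispReflGraph : ∀ {a b} {𝒢 : ReflGraph a b}
    → SmallDispReflGraph 𝒰 𝒢 → SmallDispReflGraph 𝒰 (opReflGraph 𝒢)
  opSmallDispReflGraph ℬ = record { dVert = dVert ; dEdge = λ p v w → dEdge p w v ; dRx = dRx }
    where open SmallDispReflGraph ℬ

  module Contravariant {a b} (𝒜 : ReflGraph a b) where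

    laxLens↔opLens : LaxContraLens 𝒰 𝒜 ↔ OplaxCovLens 𝒰 (opReflGraph 𝒜)
    laxLens↔opLens = mk↔ₛ′ to from to-from from-to
      where
      to : LaxContraLens 𝒰 𝒜 → OplaxCovLens 𝒰 (opReflGraph 𝒜)
      to L = record { fam = λ x → opSmallReflGraph (fam x)
                    ; pathObj = λ x → opReflGraph-isPathObject (toReflGraph 𝒰 (fam x)) (pathObj x)
                    ; push = pull ; pushRx = pullRx }
        where open LaxContraLens L
      from : OplaxCovLens 𝒰 (opReflGraph 𝒜) → LaxContraLens 𝒰 𝒜
      from L = record { fam = λ x → opSmallReflGraph (fam x)
                      ; pathObj = λ x → opReflGraph-isPathObject (toReflGraph 𝒰 (fam x)) (pathObj x)
                      ; pull = push ; pullRx = pushRx }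
        where open OplaxCovLens L
      from-to : ∀ L → from (to L) ≡ L
      from-to L = cong (λ po → record { fam = fam ; pathObj = po ; pull = pull ; pullRx = pullRx })
        (fe λ x → isPathObject-isProp fe (toReflGraph 𝒰 (fam x)) _ _)
        where open LaxContraLens L
      to-from : ∀ L → to (from L) ≡ L
      to-from L = cong (λ po → record { fam = fam ; pathObj = po ; push = push ; pushRx = pushRx })
        (fe λ x → isPathObject-isProp fe (toReflGraph 𝒰 (fam x)) _ _)
        where open OplaxCovLens L

    opFibration↔fibration : CovFibration 𝒰 (opReflGraph 𝒜) ↔ ContraFibration 𝒰 𝒜
    opFibration↔fibration = mk↔ₛ′
      (λ (ℬ , cov) → opSmallDispReflGraph ℬ , λ p → cov p)
      (λ (ℬ , contra) → opSmallDispReflGraph ℬ , λ p → contra p)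
      (λ _ → refl) (λ _ → refl)

    lens↔fibration : LaxContraLens 𝒰 𝒜 ↔ ContraFibration 𝒰 𝒜
    lens↔fibration = ↔-trans laxLens↔opLens
      (↔-trans (Covariant.lens↔fibration (opReflGraph 𝒜)) opFibration↔fibration)

mainTheorem1 : {a b u e : Level} (𝒜 : ReflGraph a b) (𝒰 : Universe u e)
    → isUnivalent 𝒰 → FunExt
    → Equiv (OplaxCovLens 𝒰 𝒜) (CovFibration 𝒰 𝒜)
    × Equiv (LaxContraLens 𝒰 𝒜) (ContraFibration 𝒰 𝒜)
mainTheorem1 𝒜 𝒰 univ fe =
    ↔⇒Equiv (Covariant.lens↔fibration 𝒰 univ fe 𝒜)
  , ↔⇒Equiv (Contravariant.lens↔fibration 𝒰 univ fe 𝒜)
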